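{- Let $\alpha>0$ and let $G$ be an $n$-vertex graph with $\alpha n^{3/2}$ edges. Then $G$ has a subgraph $H$ on the same vertex set such that $e(H)\geq \frac12\alpha n^{3/2}$ and for every edge $uv\in E(H)$, the vertex $u$ has at least $\frac18\alpha n^{1/2}$ neighbours $w$ in $H$ such that $d_H(v,w)\geq \alpha^2/32$.
   Context: For vertices $v,w$ of a graph $H$, $d_H(v,w)$ denotes the codegree of $v$ and $w$ in $H$, i.e. the number of common neighbours of $v$ and $w$ in $H$. -}

module Defs where

open import Data.Nat using (ℕ; zero; suc; _+_; _<ᵇ_)
open import Data.Bool using (Bool; true; false; if_then_else_; _∧_)
open import Data.Fin using (Fin; toℕ) renaming (zero to fz; suc to fs)
open import Relation.Binary.PropositionalEquality using (_≡_)

sumF : ∀ {n} → (Fin n → ℕ) → ℕ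
sumF {zero} f = 0
sumF {suc n} f = f fz + sumF (λ i → f (fs i))

countF : ∀ {n} → (Fin n → Bool) → ℕ
countF p = sumF (λ i → if p i then 1 else 0)

record Graph (n : ℕ) : Set where
  field
    adj    : Fin n → Fin n → Bool
    symm   : ∀ i j → adj i j ≡ adj j i
    irrefl : ∀ i → adj i i ≡ false
open Graph public

edges : ∀ {n} → Graph n → ℕ
edges G = sumF (λ i → countF (λ j → (toℕ i <ᵇ toℕ j) ∧ adj G i j))

codeg : ∀ {n} → Graph n → Fin n → Fin n → ℕ
codeg H v w = countF (λ x → adj H v x ∧ adj H w x)

_⊆G_ : ∀ {n} → Graph n → Graph n → Set
H ⊆G G = ∀ i j → adj H i j ≡ true → adj G i j ≡ true

{-# OPTIONS --safe #-}
-- Repeatedly delete an edge uv violating the conclusion, keeping track of the potential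
--   Φ(H) = n e Σₓ min(4n·deg x, e) + Σₓ Σᵧ min(32n³·d_H(x,y), e²),   e = e(G),
-- which never exceeds 2n²e². If 4n·deg u ≤ e, deleting uv lowers the first sum by 4n.
-- Otherwise more than e/8n neighbours w of u have 32n³·d_H(v,w) < e², and each of these
-- codegrees drops by one since u is a common neighbour of v and w. Either way Φ drops by
-- c = 4n²e, so at most 2n²e²/c = e/2 edges are deleted.
module Submission where

open import Defs
open import Data.Nat
  using (ℕ; zero; suc; _+_; _*_; _^_; _⊓_; _≤_; _<_; _≤ᵇ_; _<ᵇ_; _≤?_; z≤n; z<s; >-nonZero)
open import Data.Nat.Properties hiding (_≟_)
open import Data.Nat.Induction using (<-wellFounded)
open import Data.Nat.Tactic.RingSolver using (solve-∀)
open import Algebra.Properties.CommutativeSemigroup +-commutativeSemigroup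
  using (interchange; x∙yz≈y∙xz)
open import Data.Bool using (Bool; true; false; if_then_else_; _∧_; _∨_; not; T; _≟_)
open import Data.Bool.Properties using (∧-comm; ∨-comm; ∧-conicalˡ; ∧-conicalʳ; ∧-identityʳ; ∧-zeroʳ; T-≡)
open import Data.Fin using (Fin; toℕ) renaming (zero to fz; suc to fs)
open import Data.Fin.Properties using (all?; ¬∀⟶∃¬) renaming (_≟_ to _≟ᶠ_; suc-injective to fs-injective)
open import Data.Product using (Σ; ∃₂; _×_; _,_; proj₁; proj₂)
open import Data.Sum using (_⊎_; inj₁; inj₂; map₂) renaming (map to ⊎-map; swap to ⊎-swap)
open import Function using (_∘_; Equivalence)
open import Induction.WellFounded using (Acc; acc)
open import Relation.Binary.PropositionalEquality
open import Relation.Nullary using (¬_; Dec; yes; no; does; contradiction)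
open import Relation.Nullary.Decidable using (dec-true; _→-dec_)

sumF-mono : ∀ {n} {f g : Fin n → ℕ} → (∀ i → f i ≤ g i) → sumF f ≤ sumF g
sumF-mono {zero}  f≤g = z≤n
sumF-mono {suc n} f≤g = +-mono-≤ (f≤g fz) (sumF-mono (f≤g ∘ fs))

sumF-+ : ∀ {n} (f g : Fin n → ℕ) → sumF (λ i → f i + g i) ≡ sumF f + sumF g
sumF-+ {zero}  f g = refl
sumF-+ {suc n} f g =
  trans (cong (f fz + g fz +_) (sumF-+ (f ∘ fs) (g ∘ fs))) (interchange (f fz) (g fz) _ _)

sumF-*ˡ : ∀ {n} k (f : Fin n → ℕ) → sumF (λ i → k * f i) ≡ k * sumF f
sumF-*ˡ {zero}  k f = sym (*-zeroʳ k)
sumF-*ˡ {suc n} k f =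
  trans (cong (k * f fz +_) (sumF-*ˡ k (f ∘ fs))) (sym (*-distribˡ-+ k (f fz) _))

sumF-≤-const : ∀ {n} {f : Fin n → ℕ} c → (∀ i → f i ≤ c) → sumF f ≤ n * c
sumF-≤-const {zero}  c f≤c = z≤n
sumF-≤-const {suc n} c f≤c = +-mono-≤ (f≤c fz) (sumF-≤-const c (f≤c ∘ fs))

sumF-+-≤ : ∀ {n} {f g h : Fin n → ℕ} → (∀ i → h i + f i ≤ g i) → sumF h + sumF f ≤ sumF g
sumF-+-≤ {f = f} {g} {h} hf≤g = subst (_≤ sumF g) (sumF-+ h f) (sumF-mono hf≤g)

sumF-+-at : ∀ {n} {f g : Fin n → ℕ} (a : Fin n) {k} →
            (∀ i → f i ≤ g i) → k + f a ≤ g a → k + sumF f ≤ sumF g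
sumF-+-at {f = f} fz     {k} f≤g k+fa≤ga = ≤-trans (≤-reflexive (sym (+-assoc k (f fz) _)))
  (+-mono-≤ k+fa≤ga (sumF-mono (f≤g ∘ fs)))
sumF-+-at {f = f} (fs a) {k} f≤g k+fa≤ga = ≤-trans (≤-reflexive (x∙yz≈y∙xz k (f fz) _))
  (+-mono-≤ (f≤g fz) (sumF-+-at a (f≤g ∘ fs) k+fa≤ga))

sumF-≤-+-at : ∀ {n} {f g : Fin n → ℕ} (a : Fin n) {k} →
              (∀ i → i ≢ a → f i ≤ g i) → f a ≤ k + g a → sumF f ≤ k + sumF g
sumF-≤-+-at {g = g} fz     {k} f≤g fa≤k+ga = ≤-trans
  (+-mono-≤ fa≤k+ga (sumF-mono λ i → f≤g (fs i) λ ()))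
  (≤-reflexive (+-assoc k (g fz) _))
sumF-≤-+-at {g = g} (fs a) {k} f≤g fa≤k+ga = ≤-trans
  (+-mono-≤ (f≤g fz λ ()) (sumF-≤-+-at a (λ i i≢a → f≤g (fs i) (i≢a ∘ fs-injective)) fa≤k+ga))
  (≤-reflexive (x∙yz≈y∙xz (g fz) k _))

indicator : Bool → ℕ
indicator b = if b then 1 else 0

indicator-mono : ∀ {a b} → (a ≡ true → b ≡ true) → indicator a ≤ indicator b
indicator-mono {false} a⇒b = z≤n
indicator-mono {true}  a⇒b rewrite a⇒b refl = ≤-refl

indicator≤1 : ∀ b → indicator b ≤ 1
indicator≤1 false = z≤n
indicator≤1 true  = ≤-refl

countF-mono : ∀ {n} {p q : Fin n → Bool} → (∀ i → p i ≡ true → q i ≡ true) → countF p ≤ countF q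
countF-mono p⇒q = sumF-mono (indicator-mono ∘ p⇒q)

countF-<-at : ∀ {n} {p q : Fin n → Bool} (a : Fin n) → (∀ i → p i ≡ true → q i ≡ true) →
              p a ≡ false → q a ≡ true → countF p < countF q
countF-<-at {p = p} {q} a p⇒q pa qa = sumF-+-at a (indicator-mono ∘ p⇒q) (step pa qa)
  where
  step : p a ≡ false → q a ≡ true → 1 + indicator (p a) ≤ indicator (q a)
  step pa qa rewrite pa | qa = ≤-refl

countF-≤-suc-at : ∀ {n} {p q : Fin n → Bool} (b : Fin n) →
                  (∀ j → j ≢ b → p j ≡ true → q j ≡ true) → countF p ≤ suc (countF q)
countF-≤-suc-at {p = p} b p⇒q =
  sumF-≤-+-at b (λ j j≢b → indicator-mono (p⇒q j j≢b)) (≤-trans (indicator≤1 (p b)) (m≤m+n 1 _))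

countF-split : ∀ {n} (p q : Fin n → Bool) →
               countF p ≡ countF (λ i → p i ∧ q i) + countF (λ i → p i ∧ not (q i))
countF-split p q = trans (sumF-cong λ i → split (p i) (q i))
  (sumF-+ (λ i → indicator (p i ∧ q i)) (λ i → indicator (p i ∧ not (q i))))
  where
  split : ∀ a b → indicator a ≡ indicator (a ∧ b) + indicator (a ∧ not b)
  split false b     = refl
  split true  false = refl
  split true  true  = refl

  sumF-cong : ∀ {n} {f g : Fin n → ℕ} → (∀ i → f i ≡ g i) → sumF f ≡ sumF g
  sumF-cong {zero}  f≡g = refl
  sumF-cong {suc n} f≡g = cong₂ _+_ (f≡g fz) (sumF-cong (f≡g ∘ fs))

∧-true : ∀ {a b} → a ≡ true → b ≡ true → (a ∧ b) ≡ true
∧-true refl refl = refl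

∧-true-mono : ∀ {a b c d} → (a ≡ true → c ≡ true) → (b ≡ true → d ≡ true) →
              (a ∧ b) ≡ true → (c ∧ d) ≡ true
∧-true-mono a⇒c b⇒d ab = ∧-true (a⇒c (∧-conicalˡ _ _ ab)) (b⇒d (∧-conicalʳ _ _ ab))

∨-true : ∀ {a b} → (a ∨ b) ≡ true → a ≡ true ⊎ b ≡ true
∨-true {true}  _   = inj₁ refl
∨-true {false} a∨b = inj₂ a∨b

≟-true : ∀ {n} (i j : Fin n) → does (i ≟ᶠ j) ≡ true → i ≡ j
≟-true i j with i ≟ᶠ j
... | yes i≡j = λ _ → i≡j
... | no  _   = λ ()

⊆G-refl : ∀ {n} {H : Graph n} → H ⊆G H
⊆G-refl i j ij = ij

⊆G-trans : ∀ {n} {F G H : Graph n} → F ⊆G G → G ⊆G H → F ⊆G H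
⊆G-trans F⊆G G⊆H i j = G⊆H i j ∘ F⊆G i j

degree : ∀ {n} → Graph n → Fin n → ℕ
degree H x = countF (adj H x)

degree-mono : ∀ {n} {F H : Graph n} → F ⊆G H → ∀ x → degree F x ≤ degree H x
degree-mono F⊆H x = countF-mono (F⊆H x)

codeg-mono : ∀ {n} {F H : Graph n} → F ⊆G H → ∀ x y → codeg F x y ≤ codeg H x y
codeg-mono F⊆H x y = countF-mono λ z → ∧-true-mono (F⊆H x z) (F⊆H y z)

Ends : ∀ {n} → Fin n → Fin n → Fin n → Fin n → Set
Ends u v i j = (i ≡ u × j ≡ v) ⊎ (i ≡ v × j ≡ u)

sameEnds : ∀ {n} → Fin n → Fin n → Fin n → Fin n → Bool
sameEnds u v i j = (does (i ≟ᶠ u) ∧ does (j ≟ᶠ v)) ∨ (does (i ≟ᶠ v) ∧ does (j ≟ᶠ u))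

sameEnds-comm : ∀ {n} (u v i j : Fin n) → sameEnds u v i j ≡ sameEnds u v j i
sameEnds-comm u v i j =
  trans (cong₂ _∨_ (∧-comm (does (i ≟ᶠ u)) _) (∧-comm (does (i ≟ᶠ v)) _))
        (∨-comm (does (j ≟ᶠ v) ∧ does (i ≟ᶠ u)) _)

sameEnds-sound : ∀ {n} (u v i j : Fin n) → sameEnds u v i j ≡ true → Ends u v i j
sameEnds-sound u v i j same = ⊎-map (both u v) (both v u) (∨-true same)
  where
  both : ∀ x y → (does (i ≟ᶠ x) ∧ does (j ≟ᶠ y)) ≡ true → i ≡ x × j ≡ y
  both x y ij = ≟-true i x (∧-conicalˡ _ _ ij) , ≟-true j y (∧-conicalʳ _ _ ij)

deleteEdge : ∀ {n} → Graph n → Fin n → Fin n → Graph n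
deleteEdge H u v = record
  { adj    = λ i j → adj H i j ∧ not (sameEnds u v i j)
  ; symm   = λ i j → cong₂ (λ a s → a ∧ not s) (symm H i j) (sameEnds-comm u v i j)
  ; irrefl = λ i → cong (_∧ not (sameEnds u v i i)) (irrefl H i)
  }

module _ {n} (H : Graph n) (u v : Fin n) where

  deleteEdge-⊆ : deleteEdge H u v ⊆G H
  deleteEdge-⊆ i j = ∧-conicalˡ _ _

  deleteEdge-removes : adj (deleteEdge H u v) u v ≡ false
  deleteEdge-removes rewrite dec-true (u ≟ᶠ u) refl | dec-true (v ≟ᶠ v) refl = ∧-zeroʳ (adj H u v)

  deleteEdge-removes′ : adj (deleteEdge H u v) v u ≡ false
  deleteEdge-removes′ = trans (symm (deleteEdge H u v) v u) deleteEdge-removes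

  deleteEdge-keeps : ∀ i j → adj H i j ≡ true → adj (deleteEdge H u v) i j ≡ true ⊎ Ends u v i j
  deleteEdge-keeps i j ij with sameEnds u v i j in same
  ... | true  = inj₂ (sameEnds-sound u v i j same)
  ... | false = inj₁ (trans (∧-identityʳ (adj H i j)) ij)

  module _ (uv : adj H u v ≡ true) where

    degree-deleteEdge : degree (deleteEdge H u v) u < degree H u
    degree-deleteEdge = countF-<-at v (deleteEdge-⊆ u) deleteEdge-removes uv

    codeg-deleteEdge : ∀ w → adj H u w ≡ true → codeg (deleteEdge H u v) v w < codeg H v w
    codeg-deleteEdge w uw = countF-<-at u
      (λ x → ∧-true-mono (deleteEdge-⊆ v x) (deleteEdge-⊆ w x))
      (cong (_∧ adj (deleteEdge H u v) w u) deleteEdge-removes′)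
      (∧-true (trans (symm H v u) uv) (trans (symm H w u) uw))

edges-≤-offEdge : ∀ {n} (H F : Graph n) (a b : Fin n) → toℕ a ≤ toℕ b →
                  (∀ i j → adj H i j ≡ true → adj F i j ≡ true ⊎ Ends a b i j) →
                  edges H ≤ suc (edges F)
edges-≤-offEdge H F a b a≤b keeps = sumF-≤-+-at a
  (λ i i≢a → countF-mono λ j → kept i j (i≢a ∘ proj₁))
  (countF-≤-suc-at b (λ j j≢b → kept a j (j≢b ∘ proj₂)))
  where
  kept : ∀ i j → ¬ (i ≡ a × j ≡ b) →
         ((toℕ i <ᵇ toℕ j) ∧ adj H i j) ≡ true → ((toℕ i <ᵇ toℕ j) ∧ adj F i j) ≡ true
  kept i j ¬ab ij with keeps i j (∧-conicalʳ _ _ ij)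
  ... | inj₁ Fij = ∧-true (∧-conicalˡ _ _ ij) Fij
  ... | inj₂ (inj₁ ab) = contradiction ab ¬ab
  ... | inj₂ (inj₂ (refl , refl)) =
    -- the reversed pair (b , a) is never counted by edges, as b < a fails
    contradiction (<ᵇ⇒< (toℕ b) (toℕ a) (Equivalence.from T-≡ (∧-conicalˡ _ _ ij))) (≤⇒≯ a≤b)

edges-deleteEdge : ∀ {n} (H : Graph n) u v → edges H ≤ suc (edges (deleteEdge H u v))
edges-deleteEdge H u v with ≤-total (toℕ u) (toℕ v)
... | inj₁ u≤v = edges-≤-offEdge H (deleteEdge H u v) u v u≤v (deleteEdge-keeps H u v)
... | inj₂ v≤u = edges-≤-offEdge H (deleteEdge H u v) v u v≤u
  λ i j → map₂ ⊎-swap ∘ deleteEdge-keeps H u v i j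

¬-implication : ∀ {b : Bool} {B : Set} → ¬ (b ≡ true → B) → b ≡ true × ¬ B
¬-implication {true}  ¬b⇒B = refl , λ B → ¬b⇒B λ _ → B
¬-implication {false} ¬b⇒B = contradiction (λ ()) ¬b⇒B

module Pruning {n} (Good : Graph n → Fin n → Fin n → Set)
               (good? : ∀ H u v → Dec (Good H u v))
               (Φ : Graph n → ℕ) (c : ℕ) (c>0 : 0 < c)
               (Φ-drop : ∀ H u v → adj H u v ≡ true → ¬ Good H u v →
                         c + Φ (deleteEdge H u v) ≤ Φ H) where

  Pruned : Graph n → Set
  Pruned H = ∀ u v → adj H u v ≡ true → Good H u v

  edgeGood? : ∀ H u v → Dec (adj H u v ≡ true → Good H u v)
  edgeGood? H u v = (adj H u v ≟ true) →-dec good? H u v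

  pruned-or-bad : ∀ H → Pruned H ⊎ ∃₂ λ u v → adj H u v ≡ true × ¬ Good H u v
  pruned-or-bad H with all? (λ u → all? (edgeGood? H u))
  ... | yes pruned = inj₁ pruned
  ... | no ¬pruned with ¬∀⟶∃¬ n _ (λ u → all? (edgeGood? H u)) ¬pruned
  ...   | u , ¬prunedᵤ with ¬∀⟶∃¬ n _ (edgeGood? H u) ¬prunedᵤ
  ...     | v , ¬good = inj₂ (u , v , ¬-implication ¬good)

  deletion-bound : ∀ H u v → adj H u v ≡ true → ¬ Good H u v → ∀ {b} →
                   c * edges (deleteEdge H u v) ≤ Φ (deleteEdge H u v) + b → c * edges H ≤ Φ H + b
  deletion-bound H u v uv bad {b} bound = begin
    c * edges H                  ≤⟨ *-monoʳ-≤ c (edges-deleteEdge H u v) ⟩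
    c * suc (edges H′)           ≡⟨ *-suc c (edges H′) ⟩
    c + c * edges H′             ≤⟨ +-monoʳ-≤ c bound ⟩
    c + (Φ H′ + b)               ≡⟨ +-assoc c (Φ H′) b ⟨
    c + Φ H′ + b                 ≤⟨ +-monoˡ-≤ b (Φ-drop H u v uv bad) ⟩
    Φ H + b                      ∎
    where
    open ≤-Reasoning
    H′ = deleteEdge H u v

  Φ-decreases : ∀ H u v → adj H u v ≡ true → ¬ Good H u v → Φ (deleteEdge H u v) < Φ H
  Φ-decreases H u v uv bad = ≤-trans (+-monoˡ-≤ _ c>0) (Φ-drop H u v uv bad)

  prune : (G : Graph n) → Σ (Graph n) λ H → H ⊆G G × c * edges G ≤ Φ G + c * edges H × Pruned H
  prune G = go G (<-wellFounded (Φ G))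
    where
    go : (G : Graph n) → Acc _<_ (Φ G) →
         Σ (Graph n) λ H → H ⊆G G × c * edges G ≤ Φ G + c * edges H × Pruned H
    go G (acc smaller) with pruned-or-bad G
    ... | inj₁ pruned = G , ⊆G-refl {H = G} , m≤n+m (c * edges G) (Φ G) , pruned
    ... | inj₂ (u , v , uv , bad) with go (deleteEdge G u v) (smaller (Φ-decreases G u v uv bad))
    ...   | H , H⊆G′ , bound , pruned =
      H , ⊆G-trans {F = H} {deleteEdge G u v} {G} H⊆G′ (deleteEdge-⊆ G u v) ,
      deletion-bound G u v uv bad bound , pruned

≤ᵇ≡false⇒> : ∀ {a b} → (a ≤ᵇ b) ≡ false → b < a
≤ᵇ≡false⇒> a≰ᵇb = ≰⇒> λ a≤b → subst T a≰ᵇb (≤⇒≤ᵇ a≤b)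

capped-step : ∀ k {a b} m → a < b → k * b ≤ m → k + (k * a) ⊓ m ≤ (k * b) ⊓ m
capped-step k {a} {b} m a<b kb≤m = begin
  k + (k * a) ⊓ m  ≤⟨ +-monoʳ-≤ k (m⊓n≤m (k * a) m) ⟩
  k + k * a        ≡⟨ *-suc k a ⟨
  k * suc a        ≤⟨ *-monoʳ-≤ k a<b ⟩
  k * b            ≡⟨ m≤n⇒m⊓n≡m kb≤m ⟨
  (k * b) ⊓ m      ∎
  where open ≤-Reasoning

*-pos : ∀ {m k} → 0 < m → 0 < k → 0 < m * k
*-pos {suc _} {suc _} _ _ = z<s

module CodegreePotential (n e : ℕ) where

  K : ℕ
  K = 32 * n ^ 3

  Rich : Graph n → Fin n → Fin n → Bool
  Rich H v w = e ^ 2 ≤ᵇ K * codeg H v w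

  Good : Graph n → Fin n → Fin n → Set
  Good H u v = e ≤ 8 * n * countF (λ w → adj H u w ∧ Rich H v w)

  good? : ∀ H u v → Dec (Good H u v)
  good? H u v = e ≤? _

  degreeWeight : Graph n → Fin n → ℕ
  degreeWeight H x = (4 * n * degree H x) ⊓ e

  codegWeight : Graph n → Fin n → Fin n → ℕ
  codegWeight H x y = (K * codeg H x y) ⊓ e ^ 2

  codegTotal : Graph n → ℕ
  codegTotal H = sumF λ x → sumF (codegWeight H x)

  Φ : Graph n → ℕ
  Φ H = n * e * sumF (degreeWeight H) + codegTotal H

  c : ℕ
  c = n * e * (4 * n)

  Φ-bound : ∀ H → Φ H ≤ n * e * (n * e) + n * (n * e ^ 2)
  Φ-bound H = +-mono-≤
    (*-monoʳ-≤ (n * e) (sumF-≤-const {f = degreeWeight H} e λ x → m⊓n≤n _ e))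
    (sumF-≤-const {f = λ x → sumF (codegWeight H x)} (n * e ^ 2) λ x →
       sumF-≤-const {f = codegWeight H x} (e ^ 2) λ y → m⊓n≤n _ (e ^ 2))

  module _ (H : Graph n) (u v : Fin n) (uv : adj H u v ≡ true) where

    private
      H′ = deleteEdge H u v

    degreeWeight-mono : ∀ x → degreeWeight H′ x ≤ degreeWeight H x
    degreeWeight-mono x =
      ⊓-monoˡ-≤ e (*-monoʳ-≤ (4 * n) (degree-mono {F = H′} {H} (deleteEdge-⊆ H u v) x))

    codegWeight-mono : ∀ x y → codegWeight H′ x y ≤ codegWeight H x y
    codegWeight-mono x y =
      ⊓-monoˡ-≤ (e ^ 2) (*-monoʳ-≤ K (codeg-mono {F = H′} {H} (deleteEdge-⊆ H u v) x y))

    codegTotal-mono : codegTotal H′ ≤ codegTotal H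
    codegTotal-mono = sumF-mono λ x → sumF-mono (codegWeight-mono x)

    Φ-drop-lowDegree : 4 * n * degree H u ≤ e → c + Φ H′ ≤ Φ H
    Φ-drop-lowDegree low = begin
      c + (n * e * D′ + codegTotal H′)  ≡⟨ +-assoc c _ _ ⟨
      c + n * e * D′ + codegTotal H′    ≡⟨ cong (_+ codegTotal H′) (*-distribˡ-+ (n * e) (4 * n) D′) ⟨
      n * e * (4 * n + D′) + codegTotal H′
        ≤⟨ +-mono-≤ (*-monoʳ-≤ (n * e) degreeSum-drop) codegTotal-mono ⟩
      Φ H                               ∎
      where
      open ≤-Reasoning
      D′ = sumF (degreeWeight H′)
      degreeSum-drop : 4 * n + D′ ≤ sumF (degreeWeight H)
      degreeSum-drop = sumF-+-at u degreeWeight-mono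
        (capped-step (4 * n) e (degree-deleteEdge H u v uv) low)

    Φ-drop-highDegree : ¬ Good H u v → e < 4 * n * degree H u → c + Φ H′ ≤ Φ H
    Φ-drop-highDegree bad high = begin
      c + (n * e * D′ + codegTotal H′)  ≡⟨ x∙yz≈y∙xz c (n * e * D′) (codegTotal H′) ⟩
      n * e * D′ + (c + codegTotal H′)
        ≤⟨ +-mono-≤ (*-monoʳ-≤ (n * e) (sumF-mono degreeWeight-mono))
                    (≤-trans (+-monoˡ-≤ _ c≤K*poor) codegTotal-drop) ⟩
      Φ H                               ∎
      where
      open ≤-Reasoning
      D′ = sumF (degreeWeight H′)
      Poor : Fin n → Bool
      Poor w = adj H u w ∧ not (Rich H v w)
      poor = countF Poor
      rich = countF (λ w → adj H u w ∧ Rich H v w)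

      many-poor : e ≤ 8 * n * poor
      many-poor = +-cancelˡ-≤ (8 * n * rich) e (8 * n * poor) (begin
        8 * n * rich + e                       ≤⟨ +-monoˡ-≤ e (<⇒≤ (≰⇒> bad)) ⟩
        e + e                                  ≤⟨ +-mono-≤ (<⇒≤ high) (<⇒≤ high) ⟩
        4 * n * degree H u + 4 * n * degree H u
          ≡⟨ cong (λ d → 4 * n * d + 4 * n * d) (countF-split (adj H u) (Rich H v)) ⟩
        4 * n * (rich + poor) + 4 * n * (rich + poor) ≡⟨ double n rich poor ⟩
        8 * n * rich + 8 * n * poor            ∎)
        where
        double : ∀ n r p → 4 * n * (r + p) + 4 * n * (r + p) ≡ 8 * n * r + 8 * n * p
        double = solve-∀

      c≤K*poor : c ≤ K * poor
      c≤K*poor = begin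
        n * e * (4 * n)              ≡⟨ reorder n e ⟩
        n * (4 * n) * e              ≤⟨ *-monoʳ-≤ (n * (4 * n)) many-poor ⟩
        n * (4 * n) * (8 * n * poor) ≡⟨ cube n poor ⟩
        32 * n ^ 3 * poor            ∎
        where
        reorder : ∀ n e → n * e * (4 * n) ≡ n * (4 * n) * e
        reorder = solve-∀
        -- n ^ 3 written out: the ring solver does not interpret _^_
        cube : ∀ n p → n * (4 * n) * (8 * n * p) ≡ 32 * (n * (n * (n * 1))) * p
        cube = solve-∀

      poor-drop : ∀ w → K * indicator (Poor w) + codegWeight H′ v w ≤ codegWeight H v w
      poor-drop w with adj H u w in uw | Rich H v w in notRich
      ... | true  | false rewrite *-identityʳ K =
        capped-step K (e ^ 2) (codeg-deleteEdge H u v uv w uw) (<⇒≤ (≤ᵇ≡false⇒> notRich))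
      ... | true  | true  rewrite *-zeroʳ K = codegWeight-mono v w
      ... | false | _     rewrite *-zeroʳ K = codegWeight-mono v w

      row-drop : K * poor + sumF (codegWeight H′ v) ≤ sumF (codegWeight H v)
      row-drop = begin
        K * poor + sumF (codegWeight H′ v)
          ≡⟨ cong (_+ sumF (codegWeight H′ v)) (sumF-*ˡ K (indicator ∘ Poor)) ⟨
        sumF (λ w → K * indicator (Poor w)) + sumF (codegWeight H′ v) ≤⟨ sumF-+-≤ poor-drop ⟩
        sumF (codegWeight H v)                                        ∎

      codegTotal-drop : K * poor + codegTotal H′ ≤ codegTotal H
      codegTotal-drop = sumF-+-at v (λ x → sumF-mono (codegWeight-mono x)) row-drop

  Φ-drop : ∀ H u v → adj H u v ≡ true → ¬ Good H u v → c + Φ (deleteEdge H u v) ≤ Φ H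
  Φ-drop H u v uv bad with 4 * n * degree H u ≤? e
  ... | yes low  = Φ-drop-lowDegree H u v uv low
  ... | no  high = Φ-drop-highDegree H u v uv bad (≰⇒> high)

  module _ (n>0 : 0 < n) (e>0 : 0 < e) where

    c>0 : 0 < c
    c>0 = *-pos (*-pos n>0 e>0) (*-pos {4} z<s n>0)

    halving : ∀ {h} → c * e ≤ n * e * (n * e) + n * (n * e ^ 2) + c * h → e ≤ 2 * h
    halving {h} bound = +-cancelˡ-≤ e e (2 * h) (*-cancelˡ-≤ Q {{>-nonZero Q>0}} (begin
      Q * (e + e)                                       ≡⟨ scale n e ⟩
      c * e                                             ≤⟨ bound ⟩
      n * e * (n * e) + n * (n * e ^ 2) + c * h         ≡⟨ scale′ n e h ⟨
      Q * (e + 2 * h)                                   ∎))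
      where
      open ≤-Reasoning
      Q = 2 * n * n * e
      Q>0 : 0 < Q
      Q>0 = *-pos (*-pos (*-pos {2} z<s n>0) n>0) e>0
      scale : ∀ n e → 2 * n * n * e * (e + e) ≡ n * e * (4 * n) * e
      scale = solve-∀
      scale′ : ∀ n e h → 2 * n * n * e * (e + 2 * h)
                         ≡ n * e * (n * e) + n * (n * (e * (e * 1))) + n * e * (4 * n) * h
      scale′ = solve-∀

lemma2p2 : (n : ℕ) (G : Graph n) → (0 < edges G ⊎ n ≡ 0) →
    Σ (Graph n) λ H → H ⊆G G × edges G ≤ 2 * edges H ×
      (∀ (u v : Fin n) → adj H u v ≡ true →
        edges G ≤ 8 * n * countF (λ w → adj H u w ∧ (edges G ^ 2 ≤ᵇ 32 * n ^ 3 * codeg H v w)))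
lemma2p2 zero    G _         = G , ⊆G-refl {H = G} , z≤n , λ ()
lemma2p2 (suc _) G (inj₂ ())
lemma2p2 n@(suc _) G (inj₁ e>0) =
  let H , H⊆G , bound , pruned = prune G
  in  H , H⊆G , halving z<s e>0 (≤-trans bound (+-monoˡ-≤ _ (Φ-bound G))) , pruned
  where
  open CodegreePotential n (edges G)
  open Pruning Good good? Φ c (c>0 z<s e>0) Φ-drop
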